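{- For every $k\in\mathbb{N}$ there exists a set $A_k\subset\mathbb{N}$ such that $\{1,\dots,k-1\}\subset A_k$, $k\notin A_k$, $\mathbb{N}\setminus A_k$ is infinite and $\Pr(A_k)$ is finite.
   Context: For $m\in\mathbb{N}$, $D(m)$ is the set of positive divisors of $m$. For $A\subset\mathbb{N}$, $S_A=\sum_{a\in A}a$ ($S_\emptyset=0$), and $A$ is a practical set if every non-negative integer $k\le S_A$ is a sum of distinct elements of $A$. A number $m\in\mathbb{N}$ is $A$-practical if $D(m)\cap A$ is a practical set, and $\Pr(A)$ is the set of all $A$-practical numbers. -}

module Defs where

open import Level using (0ℓ)
open import Data.Nat using (ℕ; suc; _≤_; _<_)
open import Data.Nat.Divisibility using (_∣_; _∣?_)
open import Data.List using (List; filter; applyUpTo)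
open import Data.Nat.ListAction using (sum)
open import Data.List.Relation.Binary.Sublist.Propositional using (_⊆_)
open import Data.Product using (Σ; ∃-syntax; _×_; _,_)
open import Relation.Nullary.Decidable using (_×-dec_)
open import Relation.Unary using (Pred; Decidable)
open import Relation.Nullary using (¬_)
open import Relation.Binary.PropositionalEquality using (_≡_)

SubsetOfℕ : Set₁
SubsetOfℕ = Σ (Pred ℕ 0ℓ) Decidable

_∈ˢ_ : ℕ → SubsetOfℕ → Set
n ∈ˢ (A , _) = A n

-- A finite set given by a duplicate-free list L is practical iff every
-- k ≤ S_L is the sum of distinct elements of L, i.e. of a sublist of L.
IsPracticalList : List ℕ → Set
IsPracticalList L = ∀ k → k ≤ sum L → ∃[ S ] (S ⊆ L × sum S ≡ k)

divisorsIn : SubsetOfℕ → ℕ → List ℕ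
divisorsIn (A , A?) m = filter (λ d → (d ∣? m) ×-dec A? d) (applyUpTo suc m)

APractical : SubsetOfℕ → ℕ → Set
APractical A m = IsPracticalList (divisorsIn A m)

-- m ∈ Pr(A)  (elements of ℕ are positive integers)
_∈Pr_ : ℕ → SubsetOfℕ → Set
m ∈Pr A = 1 ≤ m × APractical A m

PrFinite : SubsetOfℕ → Set
PrFinite A = ∃[ N ] (∀ m → m ∈Pr A → m ≤ N)

ComplementInfinite : SubsetOfℕ → Set
ComplementInfinite A = ∀ N → ∃[ n ] (N < n × ¬ (n ∈ˢ A))

-- For k ≥ 1 let A consist of 1, …, k − 1 together with every n > k² that is not
-- ≡ 2 (mod 4). Every m contains a divisor d ≥ m/2 that is not ≡ 2 (mod 4) (m itself,
-- or m/2 when m ≡ 2 (mod 4)), so for m > 2k² the set D(m) ∩ A has an element above k².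
-- Then D(m) ∩ A cannot represent k²: distinct elements below k sum to less than k², and
-- any subset containing an element above k² sums to more. Hence Pr(A) ⊆ [1, 2k²], while
-- k and all large n ≡ 2 (mod 4) lie outside A.
module Submission where

open import Defs
open import Data.Nat using (ℕ; zero; suc; _+_; _*_; _∸_; _≤_; _<_; z≤n; s≤s; z<s; _≤?_; _<?_)
open import Data.Nat.Properties
open import Data.Nat.Divisibility using (_∣_; _∣?_; divides; ∣-refl; ∣-trans; ∣⇒≤; m∣m*n; ∣m+n∣m⇒∣n; ∣m∣n⇒∣m+n)
open import Data.Nat.ListAction using (sum)
open import Data.List using (List; []; _∷_; applyUpTo)
open import Data.List.Relation.Binary.Sublist.Propositional using (_⊆_; []; _∷_; _∷ʳ_; ⊆-trans)
open import Data.List.Relation.Binary.Sublist.Propositional.Properties using (All-resp-⊆; filter-⊆)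
open import Data.List.Relation.Unary.All as All using (All; []; _∷_)
open import Data.List.Relation.Unary.All.Properties using (all-filter)
open import Data.List.Relation.Unary.Any using (here; there)
open import Data.List.Membership.Propositional using (_∈_)
open import Data.List.Membership.Propositional.Properties using (∈-applyUpTo⁺; ∈-filter⁺)
open import Data.Product using (∃-syntax; _×_; _,_)
open import Data.Sum using (_⊎_; inj₁; inj₂)
open import Data.Empty using (⊥-elim)
open import Function using (_∘_)
open import Relation.Nullary using (¬_; Dec; yes; no)
open import Relation.Nullary.Decidable using (_×-dec_; _⊎-dec_; ¬?)
open import Relation.Binary.PropositionalEquality using (_≡_; refl; sym; trans; cong; subst)

∈⇒≤sum : ∀ {n ns} → n ∈ ns → n ≤ sum ns
∈⇒≤sum {ns = n ∷ ns} (here refl) = m≤m+n n (sum ns)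
∈⇒≤sum {ns = m ∷ ns} (there n∈ns) = ≤-trans (∈⇒≤sum n∈ns) (m≤n+m (sum ns) m)

shift-lower-bound : ∀ {f : ℕ → ℕ} {a} → (∀ i → a + i ≤ f i) → ∀ i → suc a + i ≤ f (suc i)
shift-lower-bound {f} {a} f≥ i = subst (_≤ f (suc i)) (+-suc a i) (f≥ (suc i))

all-small⊎sum-large : ∀ {k T ns} → All (λ d → d < k ⊎ T < d) ns → All (_< k) ns ⊎ T < sum ns
all-small⊎sum-large [] = inj₁ []
all-small⊎sum-large {ns = n ∷ ns} (inj₂ T<n ∷ _) = inj₂ (<-≤-trans T<n (m≤m+n n (sum ns)))
all-small⊎sum-large {ns = n ∷ ns} (inj₁ n<k ∷ ps) with all-small⊎sum-large ps
... | inj₁ small = inj₁ (n<k ∷ small)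
... | inj₂ T<sum = inj₂ (<-≤-trans T<sum (m≤n+m (sum ns) n))

-- The i-th entry of applyUpTo f n is at least a + i, so at most k ∸ a entries of a
-- sublist lie below k, each contributing less than k.
sum-⊆-applyUpTo-< : ∀ {k} n (f : ℕ → ℕ) a {ns} → (∀ i → a + i ≤ f i) →
                    ns ⊆ applyUpTo f n → All (_< k) ns → sum ns ≤ (k ∸ a) * k
sum-⊆-applyUpTo-< zero f a f≥ [] [] = z≤n
sum-⊆-applyUpTo-< {k} (suc n) f a {ns} f≥ (_ ∷ʳ ns⊆) small = begin
  sum ns               ≤⟨ sum-⊆-applyUpTo-< n (f ∘ suc) (suc a) (shift-lower-bound f≥) ns⊆ small ⟩
  (k ∸ suc a) * k      ≤⟨ *-monoˡ-≤ k (∸-monoʳ-≤ k (n≤1+n a)) ⟩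
  (k ∸ a) * k          ∎
  where open ≤-Reasoning
sum-⊆-applyUpTo-< {k} (suc n) f a {_ ∷ ns} f≥ (refl ∷ ns⊆) (f0<k ∷ small) = begin
  f 0 + sum ns         ≤⟨ +-mono-≤ (<⇒≤ f0<k) (sum-⊆-applyUpTo-< n (f ∘ suc) (suc a) (shift-lower-bound f≥) ns⊆ small) ⟩
  k + (k ∸ suc a) * k  ≡⟨ cong (_* k) (+-∸-assoc 1 a<k) ⟨
  (k ∸ a) * k          ∎
  where
  open ≤-Reasoning
  a<k : a < k
  a<k = ≤-<-trans (subst (_≤ f 0) (+-identityʳ a) (f≥ 0)) f0<k

-- The target k² is unreachable: below it, distinct elements smaller than k sum to at
-- most (k − 1)k; above it, any element larger than k² overshoots.
gap⇒¬practical : ∀ {k m ds x} → ds ⊆ applyUpTo suc m →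
                 All (λ d → d < suc k ⊎ suc k * suc k < d) ds →
                 x ∈ ds → suc k * suc k < x → ¬ IsPracticalList ds
gap⇒¬practical {k} {m} {ds} ds⊆ split x∈ds T<x practical
  with practical (suc k * suc k) (<⇒≤ (<-≤-trans T<x (∈⇒≤sum x∈ds)))
... | ns , ns⊆ds , sum≡T with all-small⊎sum-large (All-resp-⊆ ns⊆ds split)
...   | inj₂ T<sum = <-irrefl (sym sum≡T) T<sum
...   | inj₁ small = <-irrefl sum≡T (≤-<-trans sum≤ (m<n+m (k * suc k) z<s))
  where
  sum≤ : sum ns ≤ k * suc k
  sum≤ = sum-⊆-applyUpTo-< m suc 1 (λ _ → ≤-refl) (⊆-trans ns⊆ds ds⊆) small

divisorsIn-⊆ : ∀ A m → divisorsIn A m ⊆ applyUpTo suc m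
divisorsIn-⊆ (P , P?) m = filter-⊆ (λ d → (d ∣? m) ×-dec P? d) (applyUpTo suc m)

divisorsIn-∣ : ∀ A m → All (λ d → d ∣ m × d ∈ˢ A) (divisorsIn A m)
divisorsIn-∣ (P , P?) m = all-filter (λ d → (d ∣? m) ×-dec P? d) (applyUpTo suc m)

∈-divisorsIn : ∀ A {m d} → 1 ≤ d → d ∣ suc m → d ∈ˢ A → d ∈ divisorsIn A (suc m)
∈-divisorsIn (P , P?) {m} {suc _} _ d∣m d∈A =
  ∈-filter⁺ (λ d → (d ∣? suc m) ×-dec P? d) (∈-applyUpTo⁺ suc (∣⇒≤ d∣m)) (d∣m , d∈A)

SinglyEven : ℕ → Set
SinglyEven n = 2 ∣ n × ¬ (4 ∣ n)

singlyEven? : ∀ n → Dec (SinglyEven n)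
singlyEven? n = (2 ∣? n) ×-dec ¬? (4 ∣? n)

singlyEven-2+4* : ∀ j → SinglyEven (2 + 4 * j)
singlyEven-2+4* j = ∣m∣n⇒∣m+n ∣-refl (∣-trans (divides 2 refl) (m∣m*n j)) , 4∤
  where
  4∤ : ¬ (4 ∣ 2 + 4 * j)
  4∤ 4∣ with ∣⇒≤ (∣m+n∣m⇒∣n (subst (4 ∣_) (+-comm 2 (4 * j)) 4∣) (m∣m*n j))
  ... | s≤s (s≤s ())

half-divisor-¬singlyEven : ∀ m → ∃[ d ] (d ∣ m × ¬ SinglyEven d × m ≤ 2 * d)
half-divisor-¬singlyEven m with singlyEven? m
... | no ¬even = m , ∣-refl , ¬even , m≤n*m m 2
... | yes (divides q m≡q*2 , 4∤m) = q , divides 2 (trans m≡q*2 (*-comm q 2)) , ¬even , m≤2q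
  where
  ¬even : ¬ SinglyEven q
  ¬even (divides r q≡r*2 , _) = 4∤m (divides r (trans m≡q*2 (trans (cong (_* 2) q≡r*2) (*-assoc r 2 2))))
  m≤2q : m ≤ 2 * q
  m≤2q = ≤-reflexive (trans m≡q*2 (*-comm q 2))

module _ (k′ : ℕ) where
  private
    k T : ℕ
    k = suc k′
    T = k * k

  InA : ℕ → Set
  InA n = (1 ≤ n × n < k) ⊎ (T < n × ¬ SinglyEven n)

  A : SubsetOfℕ
  A = InA , λ n → ((1 ≤? n) ×-dec (n <? k)) ⊎-dec ((T <? n) ×-dec ¬? (singlyEven? n))

  k∉A : ¬ InA k
  k∉A (inj₁ (_ , k<k)) = <-irrefl refl k<k
  k∉A (inj₂ (T<k , _)) = <-irrefl refl (<-≤-trans T<k (m≤m*n k k))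

  ℕ∖A-infinite : ComplementInfinite A
  ℕ∖A-infinite N = n , N<n , n∉A
    where
    j = N + T
    n = 2 + 4 * j
    <n : ∀ {i} → i ≤ j → i < n
    <n i≤j = s≤s (m≤n⇒m≤1+n (≤-trans i≤j (m≤n*m j 4)))
    N<n : N < n
    N<n = <n (m≤m+n N T)
    n∉A : ¬ InA n
    n∉A (inj₁ (_ , n<k)) = <-asym n<k (<n (≤-trans (m≤m*n k k) (m≤n+m T N)))
    n∉A (inj₂ (_ , ¬even)) = ¬even (singlyEven-2+4* j)

  ¬APractical : ∀ m → 2 * T < m → ¬ APractical A m
  ¬APractical (suc m) 2T<m with half-divisor-¬singlyEven (suc m)
  ... | d , d∣m , ¬even , m≤2d =
    gap⇒¬practical (divisorsIn-⊆ A (suc m)) small⊎large (∈-divisorsIn A 1≤d d∣m (inj₂ (T<d , ¬even))) T<d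
    where
    T<d : T < d
    T<d = *-cancelˡ-< 2 T d (<-≤-trans 2T<m m≤2d)
    1≤d : 1 ≤ d
    1≤d = ≤-trans (s≤s z≤n) T<d
    small⊎large : All (λ d → d < k ⊎ T < d) (divisorsIn A (suc m))
    small⊎large = All.map (λ { (_ , inj₁ (_ , d<k)) → inj₁ d<k ; (_ , inj₂ (T<d , _)) → inj₂ T<d })
                          (divisorsIn-∣ A (suc m))

  Pr-bounded : PrFinite A
  Pr-bounded = 2 * T , bounded
    where
    bounded : ∀ m → m ∈Pr A → m ≤ 2 * T
    bounded m (_ , practical) with m ≤? 2 * T
    ... | yes m≤2T = m≤2T
    ... | no m≰2T = ⊥-elim (¬APractical m (≰⇒> m≰2T) practical)

theorem4p5 : ∀ (k : ℕ) → 1 ≤ k →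
    ∃[ A ] ((∀ i → 1 ≤ i → i < k → i ∈ˢ A) × ¬ (k ∈ˢ A) × ComplementInfinite A × PrFinite A)
theorem4p5 (suc k′) _ =
  A k′ , (λ i 1≤i i<k → inj₁ (1≤i , i<k)) , k∉A k′ , ℕ∖A-infinite k′ , Pr-bounded k′
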